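{- Let $F$ be a finite family of intervals, let $s$ be a minimal bad interval for $F$, and let $t$ be an interval that is good for $F$. Then $t$ is good for $F\downarrow s$.
   Context: For integers $a<b$, $[a,b)=\{x\in\mathbb{Z}: a\le x<b\}$; an interval is a nonempty set of this form. A family is a finite set of intervals. For a set $s$, $F|s=\{f\in F: f\subseteq s\}$. For an integer $x$, $N_x F$ is the number of members of $F$ containing $x$. An interval $s$ is good for $F$ if $N_x(F|s)\le 1$ for some $x\in s$, and bad otherwise; a minimal bad interval is a bad interval containing no other bad interval. Given an interval $s$, let $[a_1,b_1),\dots,[a_k,b_k)$ be the inclusion-maximal members of $F|s$, ordered so that $a_1<\dots<a_k$ (then $b_1<\dots<b_k$). If $a_{j+1}<b_j$ for $1\le j<k$, define $F\downarrow s=(F\setminus\{[a_1,b_1),\dots,[a_k,b_k)\})\cup\{[a_2,b_1),\dots,[a_k,b_{k-1})\}$; this condition holds whenever $s$ is a minimal bad interval for $F$, so $F\downarrow s$ is then defined. -}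

module Defs where

open import Data.Integer using (ℤ; _≤_; _<_)
open import Data.Integer.Properties using (_≤?_; _<?_; _≟_)
open import Data.Nat using (ℕ)
import Data.Nat
open import Data.List using (List; []; _∷_; _++_; length; filter; deduplicate)
open import Data.List.Relation.Unary.Any using (any?)
open import Data.List.Relation.Unary.All using (All)
open import Data.Product using (_×_; _,_; proj₁; proj₂; ∃)
open import Data.Product.Properties using (≡-dec)
open import Relation.Nullary using (Dec; yes; no; ¬_; ¬?; _×-dec_)
open import Relation.Binary.PropositionalEquality using (_≡_; _≢_)

-- An interval [a,b) is represented by its pair of endpoints (a , b);
-- it is a genuine (nonempty) interval when a < b.
Iv : Set
Iv = ℤ × ℤ

lo hi : Iv → ℤ
lo = proj₁
hi = proj₂

IsInterval : Iv → Set
IsInterval f = lo f < hi f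

_≟ᵢ_ : (f g : Iv) → Dec (f ≡ g)
_≟ᵢ_ = ≡-dec _≟_ _≟_

-- A family is a finite set of intervals, represented by a list
-- (duplicates are irrelevant: all notions below only use the
-- underlying set of the list).
Family : Set
Family = List Iv

IsFamily : Family → Set
IsFamily F = All IsInterval F

_∈ᵢ_ : ℤ → Iv → Set
x ∈ᵢ f = lo f ≤ x × x < hi f

_∈ᵢ?_ : (x : ℤ) → (f : Iv) → Dec (x ∈ᵢ f)
x ∈ᵢ? f = (lo f ≤? x) ×-dec (x <? hi f)

_⊆ᵢ_ : Iv → Iv → Set
f ⊆ᵢ g = lo g ≤ lo f × hi f ≤ hi g

_⊆ᵢ?_ : (f g : Iv) → Dec (f ⊆ᵢ g)
f ⊆ᵢ? g = (lo g ≤? lo f) ×-dec (hi f ≤? hi g)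

_∣_ : Family → Iv → Family
F ∣ s = filter (_⊆ᵢ? s) F

N : ℤ → Family → ℕ
N x F = length (deduplicate _≟ᵢ_ (filter (x ∈ᵢ?_) F))

Good : Family → Iv → Set
Good F s = ∃ λ x → x ∈ᵢ s × N x (F ∣ s) Data.Nat.≤ 1

Bad : Family → Iv → Set
Bad F s = ¬ Good F s

MinimalBad : Family → Iv → Set
MinimalBad F s =
  IsInterval s × Bad F s ×
  (∀ u → IsInterval u → u ⊆ᵢ s → u ≢ s → ¬ Bad F u)

_⊊ᵢ?_ : (f g : Iv) → Dec (f ⊆ᵢ g × f ≢ g)
f ⊊ᵢ? g = (f ⊆ᵢ? g) ×-dec ¬? (f ≟ᵢ g)

maximals : Family → Iv → List Iv
maximals F s =
  deduplicate _≟ᵢ_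
    (filter (λ f → ¬? (any? (f ⊊ᵢ?_) (F ∣ s))) (F ∣ s))

insertByLo : Iv → List Iv → List Iv
insertByLo f [] = f ∷ []
insertByLo f (g ∷ gs) with lo f ≤? lo g
... | yes _ = f ∷ g ∷ gs
... | no _ = g ∷ insertByLo f gs

sortByLo : List Iv → List Iv
sortByLo [] = []
sortByLo (f ∷ fs) = insertByLo f (sortByLo fs)

consecutive : List Iv -> List Iv
consecutive (f ∷ g ∷ rest) = (lo g , hi f) ∷ consecutive (g ∷ rest)
consecutive _ = []

-- F ↓ s = (F ∖ {maximal members of F|s}) ∪ {[a₂,b₁),…,[a_k,b_{k-1})}
_↓_ : Family → Iv → Family
F ↓ s =
  filter (λ f → ¬? (any? (f ≟ᵢ_) (maximals F s))) F
  ++ consecutive (sortByLo (maximals F s))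

-- Every member of F ↓ s is either a member of F that is not maximal in F|s, or the overlap
-- [a_{j+1}, b_j) of two adjacent maximal members of F|s. Sending each overlap to one of its
-- parents (always the left one, or always the right one) is injective and keeps all points; so if
-- the parents of the overlaps inside t lie in some w ⊇ t, any point of t lying in at most one
-- member of F|w lies in at most one member of (F ↓ s)|t.
-- If t reaches to the left of s the left parents lie in t, and if it reaches to the right of s the
-- right parents do. Otherwise t lies strictly inside s, and w = [lo s, hi t) is good by minimality
-- of s, say at y. If y ∈ t we use the left parents. If y < lo t and an overlap [a_{j+1}, b_j) lies
-- in t, every member of F|s through y ends by b_j ≤ hi t, so y would make s good; and if no overlap
-- lies in t, the witness for t in F works unchanged.

module Submission where

open import Defs
open import Data.Empty using (⊥-elim)
open import Data.Integer using (ℤ; _≤_; _<_; +_; _+_; _-_; -_; ∣_∣; +<+)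
open import Data.Integer.Properties
  using (_≟_; _≤?_; ≤-refl; ≤-trans; <-trans; <-≤-trans; <⇒≤; <⇒≱; ≰⇒>; ≮⇒≥; <-irrefl;
         ≤∧≢⇒<; ≤-totalOrder; +-monoˡ-<; +-monoʳ-<; +-mono-≤-<; +-mono-<-≤; neg-mono-<; neg-mono-≤;
         i≤i+j; i≤j⇒0≤j-i; 0≤i⇒+∣i∣≡i; drop‿+<+)
open import Data.Integer.Tactic.RingSolver using (solve-∀)
open import Data.Nat as ℕ using (z≤n; s≤s; anyUpTo?)
open import Data.List using (List; []; _∷_; length; filter; deduplicate)
open import Data.List.Extrema ≤-totalOrder using (argmax; argmax-all; f[xs]≤f[argmax])
open import Data.List.Membership.Propositional using (_∈_; _∉_; find; lose)
open import Data.List.Membership.Propositional.Properties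
  using (∈-filter⁺; ∈-filter⁻; ∈-deduplicate⁺; ∈-deduplicate⁻; ∈-++⁻)
open import Data.List.Relation.Binary.Permutation.Propositional
  using (_↭_; ↭-refl; ↭-prep; ↭-swap; ↭-trans; ↭-sym; ↭⇒↭ₛ)
open import Data.List.Relation.Binary.Permutation.Propositional.Properties
  using (All-resp-↭; ∈-resp-↭)
open import Data.List.Relation.Unary.All as All using ([]; _∷_)
open import Data.List.Relation.Unary.Any using (Any; here; there; any?)
open import Data.List.Relation.Unary.AllPairs using (AllPairs; []; _∷_)
open import Data.List.Relation.Unary.Unique.Propositional using (Unique)
open import Data.List.Relation.Unary.Unique.DecPropositional.Properties using (deduplicate-!)
open import Data.Product using (_×_; _,_; proj₁; proj₂; ∃; ∃₂)
open import Data.Sum using (_⊎_; inj₁; inj₂)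
open import Function using (id; _∘_)
open import Relation.Binary.Definitions using (Reflexive)
open import Relation.Binary.PropositionalEquality
  using (_≡_; _≢_; refl; sym; cong; cong₂; subst; subst₂; setoid; module ≡-Reasoning)
open import Relation.Nullary using (Dec; yes; no; ¬_; ¬?)
open import Relation.Nullary.Decidable using (map′; decidable-stable)

import Data.List.Relation.Binary.Permutation.Setoid.Properties as Permutationₛ

private
  variable
    A : Set
    x y z : A
    xs : List A
    F : Family
    s t w f g h m : Iv

AtMostOneContains : ℤ → Family → Set
AtMostOneContains x F = ∀ {f g} → f ∈ F → g ∈ F → x ∈ᵢ f → x ∈ᵢ g → f ≡ g

length≤1⇒≡ : ∀ (xs : List A) → length xs ℕ.≤ 1 → x ∈ xs → y ∈ xs → x ≡ y
length≤1⇒≡ (_ ∷ []) _ (here refl) (here refl) = refl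
length≤1⇒≡ (_ ∷ []) _ (there ()) _
length≤1⇒≡ (_ ∷ []) _ _ (there ())
length≤1⇒≡ (_ ∷ _ ∷ _) (s≤s ()) _ _

unique∧constant⇒length≤1 : ∀ (xs : List A) → Unique xs →
  (∀ {x y} → x ∈ xs → y ∈ xs → x ≡ y) → length xs ℕ.≤ 1
unique∧constant⇒length≤1 [] _ _ = z≤n
unique∧constant⇒length≤1 (_ ∷ []) _ _ = s≤s z≤n
unique∧constant⇒length≤1 (_ ∷ _ ∷ _) ((x≢y ∷ _) ∷ _) constant =
  ⊥-elim (x≢y (constant (here refl) (there (here refl))))

containing : ℤ → Family → List Iv
containing x F = deduplicate _≟ᵢ_ (filter (x ∈ᵢ?_) F)

N≤1⇒atMostOneContains : ∀ x F → N x F ℕ.≤ 1 → AtMostOneContains x F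
N≤1⇒atMostOneContains x F N≤1 f∈F g∈F x∈f x∈g =
  length≤1⇒≡ (containing x F) N≤1 (∈-containing⁺ f∈F x∈f) (∈-containing⁺ g∈F x∈g)
  where
  ∈-containing⁺ : h ∈ F → x ∈ᵢ h → h ∈ containing x F
  ∈-containing⁺ h∈F x∈h = ∈-deduplicate⁺ _≟ᵢ_ (∈-filter⁺ (x ∈ᵢ?_) h∈F x∈h)

atMostOneContains⇒N≤1 : ∀ x F → AtMostOneContains x F → N x F ℕ.≤ 1
atMostOneContains⇒N≤1 x F atMostOne =
  unique∧constant⇒length≤1 (containing x F) (deduplicate-! _≟ᵢ_ _) λ f∈ g∈ →
    let f∈F , x∈f = ∈-containing⁻ f∈
        g∈F , x∈g = ∈-containing⁻ g∈
    in atMostOne f∈F g∈F x∈f x∈g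
  where
  ∈-containing⁻ : h ∈ containing x F → h ∈ F × x ∈ᵢ h
  ∈-containing⁻ = ∈-filter⁻ (x ∈ᵢ?_) ∘ ∈-deduplicate⁻ _≟ᵢ_ _

+∣j-i∣≡j-i : ∀ {i j} → i ≤ j → + ∣ j - i ∣ ≡ j - i
+∣j-i∣≡j-i = 0≤i⇒+∣i∣≡i ∘ i≤j⇒0≤j-i

i+∣j-i∣≡j : ∀ {i j} → i ≤ j → i + + ∣ j - i ∣ ≡ j
i+∣j-i∣≡j {i} {j} i≤j = begin
  i + + ∣ j - i ∣ ≡⟨ cong (λ k → i + k) (+∣j-i∣≡j-i i≤j) ⟩
  i + (j - i)     ≡⟨ i+[j-i]≡j i j ⟩
  j               ∎
  where
  open ≡-Reasoning
  i+[j-i]≡j : ∀ i j → i + (j - i) ≡ j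
  i+[j-i]≡j = solve-∀

module _ {P : ℤ → Set} (P? : ∀ x → Dec (P x)) where

  -- The points of [a,b) are a + k for k < ∣ b - a ∣.
  ∃-∈ᵢ? : ∀ s → lo s ≤ hi s → Dec (∃ λ x → x ∈ᵢ s × P x)
  ∃-∈ᵢ? (a , b) a≤b = map′ toPoint toOffset (anyUpTo? (λ k → P? (a + + k)) ∣ b - a ∣)
    where
    toPoint : (∃ λ k → k ℕ.< ∣ b - a ∣ × P (a + + k)) → ∃ λ x → x ∈ᵢ (a , b) × P x
    toPoint (k , k<n , Pk) =
      a + + k , (i≤i+j a (+ k) , subst (a + + k <_) (i+∣j-i∣≡j a≤b) (+-monoʳ-< a (+<+ k<n))) , Pk
    toOffset : (∃ λ x → x ∈ᵢ (a , b) × P x) → ∃ λ k → k ℕ.< ∣ b - a ∣ × P (a + + k)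
    toOffset (x , (a≤x , x<b) , Px) =
      ∣ x - a ∣ ,
      drop‿+<+ (subst₂ _<_ (sym (+∣j-i∣≡j-i a≤x)) (sym (+∣j-i∣≡j-i a≤b)) (+-monoˡ-< (- a) x<b)) ,
      subst P (sym (i+∣j-i∣≡j a≤x)) Px

Good? : ∀ F s → IsInterval s → Dec (Good F s)
Good? F s s-int = ∃-∈ᵢ? (λ x → N x (F ∣ s) ℕ.≤? 1) s (<⇒≤ s-int)

⊆ᵢ-refl : f ⊆ᵢ f
⊆ᵢ-refl = ≤-refl , ≤-refl

⊆ᵢ-trans : f ⊆ᵢ g → g ⊆ᵢ h → f ⊆ᵢ h
⊆ᵢ-trans (lo≤ , hi≤) (lo≤′ , hi≤′) = ≤-trans lo≤′ lo≤ , ≤-trans hi≤ hi≤′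

∈ᵢ-resp-⊆ᵢ : ∀ {x} → x ∈ᵢ f → f ⊆ᵢ g → x ∈ᵢ g
∈ᵢ-resp-⊆ᵢ (lo≤x , x<hi) (lo≤ , hi≤) = ≤-trans lo≤ lo≤x , <-≤-trans x<hi hi≤

size : Iv → ℤ
size f = hi f - lo f

⊊ᵢ⇒size< : f ⊆ᵢ g → f ≢ g → size f < size g
⊊ᵢ⇒size< {f} {g} (lo≤ , hi≤) f≢g with lo g ≟ lo f
... | no lo≢ = +-mono-≤-< hi≤ (neg-mono-< (≤∧≢⇒< lo≤ lo≢))
... | yes lo≡ = +-mono-<-≤ (≤∧≢⇒< hi≤ (f≢g ∘ cong₂ _,_ (sym lo≡))) (neg-mono-≤ lo≤)

∈-∣⁺ : ∀ F s → h ∈ F → h ⊆ᵢ s → h ∈ F ∣ s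
∈-∣⁺ F s = ∈-filter⁺ (_⊆ᵢ? s)

∈-∣⁻ : ∀ F s → h ∈ F ∣ s → h ∈ F × h ⊆ᵢ s
∈-∣⁻ F s = ∈-filter⁻ (_⊆ᵢ? s) {xs = F}

record IsMaximal (F : Family) (s m : Iv) : Set where
  field
    member : m ∈ F ∣ s
    maximal : ∀ {h} → h ∈ F ∣ s → m ⊆ᵢ h → m ≡ h

open IsMaximal

∈-maximals⁻ : m ∈ maximals F s → IsMaximal F s m
∈-maximals⁻ {m = m} {F = F} {s = s} m∈ =
  let m∈F∣s , noLarger = ∈-filter⁻ (λ f → ¬? (any? (f ⊊ᵢ?_) (F ∣ s))) (∈-deduplicate⁻ _≟ᵢ_ _ m∈)
  in record
    { member = m∈F∣s
    ; maximal = λ {h} h∈ m⊆h → decidable-stable (m ≟ᵢ h) λ m≢h → noLarger (lose h∈ (m⊆h , m≢h))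
    }

∈-maximals⁺ : IsMaximal F s m → m ∈ maximals F s
∈-maximals⁺ {F = F} {s = s} {m = m} m-maximal =
  ∈-deduplicate⁺ _≟ᵢ_ (∈-filter⁺ (λ f → ¬? (any? (f ⊊ᵢ?_) (F ∣ s))) (member m-maximal) noLarger)
  where
  noLarger : ¬ Any (λ g → m ⊆ᵢ g × m ≢ g) (F ∣ s)
  noLarger larger = let _ , h∈ , m⊆h , m≢h = find larger in m≢h (maximal m-maximal h∈ m⊆h)

-- A member of largest size among those containing h is maximal.
maximal-cover : h ∈ F ∣ s → ∃ λ m → IsMaximal F s m × h ⊆ᵢ m
maximal-cover {h = h} {F = F} {s = s} h∈ =
  top , record { member = top∈F∣s ; maximal = top-maximal } , h⊆top
  where
  above : List Iv
  above = filter (h ⊆ᵢ?_) (F ∣ s)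
  top : Iv
  top = argmax size h above
  top∈above : top ∈ above
  top∈above = argmax-all size (∈-filter⁺ (h ⊆ᵢ?_) h∈ ⊆ᵢ-refl) (All.tabulate id)
  top∈F∣s : top ∈ F ∣ s
  top∈F∣s = proj₁ (∈-filter⁻ (h ⊆ᵢ?_) {xs = F ∣ s} top∈above)
  h⊆top : h ⊆ᵢ top
  h⊆top = proj₂ (∈-filter⁻ (h ⊆ᵢ?_) {xs = F ∣ s} top∈above)
  top-maximal : ∀ {g} → g ∈ F ∣ s → top ⊆ᵢ g → top ≡ g
  top-maximal {g} g∈ top⊆g = decidable-stable (top ≟ᵢ g) λ top≢g →
    <⇒≱ (⊊ᵢ⇒size< top⊆g top≢g)
        (All.lookup (f[xs]≤f[argmax] h above) (∈-filter⁺ (h ⊆ᵢ?_) g∈ (⊆ᵢ-trans h⊆top top⊆g)))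

hi≤hi-maximal : IsMaximal F s m → h ∈ F ∣ s → lo h ≤ lo m → hi h ≤ hi m
hi≤hi-maximal m-maximal h∈ lo≤ =
  ≮⇒≥ λ hi< → <-irrefl (cong hi (maximal m-maximal h∈ (lo≤ , <⇒≤ hi<))) hi<

insertByLo-↭ : ∀ f fs → insertByLo f fs ↭ f ∷ fs
insertByLo-↭ f [] = ↭-refl
insertByLo-↭ f (g ∷ gs) with lo f ≤? lo g
... | yes _ = ↭-refl
... | no _ = ↭-trans (↭-prep g (insertByLo-↭ f gs)) (↭-swap g f ↭-refl)

sortByLo-↭ : ∀ fs → sortByLo fs ↭ fs
sortByLo-↭ [] = ↭-refl
sortByLo-↭ (f ∷ fs) = ↭-trans (insertByLo-↭ f (sortByLo fs)) (↭-prep f (sortByLo-↭ fs))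

LoLe : Iv → Iv → Set
LoLe f g = lo f ≤ lo g

insertByLo-sorted : ∀ f {fs} → AllPairs LoLe fs → AllPairs LoLe (insertByLo f fs)
insertByLo-sorted f {[]} [] = [] ∷ []
insertByLo-sorted f {g ∷ gs} (g≤gs ∷ gs-sorted) with lo f ≤? lo g
... | yes f≤g = (f≤g ∷ All.map (≤-trans f≤g) g≤gs) ∷ g≤gs ∷ gs-sorted
... | no f≰g =
  All-resp-↭ (↭-sym (insertByLo-↭ f gs)) (<⇒≤ (≰⇒> f≰g) ∷ g≤gs) ∷ insertByLo-sorted f gs-sorted

sortByLo-sorted : ∀ fs → AllPairs LoLe (sortByLo fs)
sortByLo-sorted [] = []
sortByLo-sorted (f ∷ fs) = insertByLo-sorted f (sortByLo-sorted fs)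

sortByLo-unique : ∀ {fs} → Unique fs → Unique (sortByLo fs)
sortByLo-unique {fs} =
  Permutationₛ.Unique-resp-↭ (setoid Iv) (↭⇒↭ₛ (↭-sym (sortByLo-↭ fs)))

data Adjacent (x y : A) : List A → Set where
  here : ∀ {zs} → Adjacent x y (x ∷ y ∷ zs)
  there : ∀ {z zs} → Adjacent x y zs → Adjacent x y (z ∷ zs)

adjacent-∈ˡ : Adjacent x y xs → x ∈ xs
adjacent-∈ˡ here = here refl
adjacent-∈ˡ (there adj) = there (adjacent-∈ˡ adj)

adjacent-∈ʳ : Adjacent x y xs → y ∈ xs
adjacent-∈ʳ here = there (here refl)
adjacent-∈ʳ (there adj) = there (adjacent-∈ʳ adj)

adjacent-∈ʳ-tail : Adjacent x y (z ∷ xs) → y ∈ xs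
adjacent-∈ʳ-tail here = here refl
adjacent-∈ʳ-tail (there adj) = adjacent-∈ʳ adj

adjacent-rel : ∀ {R : A → A → Set} → AllPairs R xs → Adjacent x y xs → R x y
adjacent-rel ((Rxy ∷ _) ∷ _) here = Rxy
adjacent-rel (_ ∷ related) (there adj) = adjacent-rel related adj

adjacent-split : ∀ {R : A → A → Set} → Reflexive R → AllPairs R xs → Adjacent x y xs →
  z ∈ xs → R z x ⊎ R y z
adjacent-split refl′ _ here (here refl) = inj₁ refl′
adjacent-split refl′ _ here (there (here refl)) = inj₂ refl′
adjacent-split _ (_ ∷ y≤ ∷ _) here (there (there z∈)) = inj₂ (All.lookup y≤ z∈)
adjacent-split _ (x≤ ∷ _) (there adj) (here refl) = inj₁ (All.lookup x≤ (adjacent-∈ˡ adj))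
adjacent-split refl′ (_ ∷ related) (there adj) (there z∈) = adjacent-split refl′ related adj z∈

adjacent-functionalʳ : Unique xs → Adjacent x y xs → Adjacent x z xs → y ≡ z
adjacent-functionalʳ _ here here = refl
adjacent-functionalʳ (x∉ ∷ _) here (there adj) = ⊥-elim (All.lookup x∉ (adjacent-∈ˡ adj) refl)
adjacent-functionalʳ (x∉ ∷ _) (there adj) here = ⊥-elim (All.lookup x∉ (adjacent-∈ˡ adj) refl)
adjacent-functionalʳ (_ ∷ unique) (there adj) (there adj′) = adjacent-functionalʳ unique adj adj′

adjacent-functionalˡ : Unique xs → Adjacent x z xs → Adjacent y z xs → x ≡ y
adjacent-functionalˡ _ here here = refl
adjacent-functionalˡ (_ ∷ z∉ ∷ _) here (there adj) = ⊥-elim (All.lookup z∉ (adjacent-∈ʳ-tail adj) refl)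
adjacent-functionalˡ (_ ∷ z∉ ∷ _) (there adj) here = ⊥-elim (All.lookup z∉ (adjacent-∈ʳ-tail adj) refl)
adjacent-functionalˡ (_ ∷ unique) (there adj) (there adj′) = adjacent-functionalˡ unique adj adj′

overlapOf : Iv → Iv → Iv
overlapOf f g = lo g , hi f

∈-consecutive⁺ : ∀ {fs} → Adjacent f g fs → overlapOf f g ∈ consecutive fs
∈-consecutive⁺ here = here refl
∈-consecutive⁺ {fs = _ ∷ _ ∷ _} (there adj) = there (∈-consecutive⁺ adj)

∈-consecutive⁻ : ∀ {fs} → h ∈ consecutive fs → ∃₂ λ f g → Adjacent f g fs × h ≡ overlapOf f g
∈-consecutive⁻ {fs = f ∷ g ∷ _} (here refl) = f , g , here , refl
∈-consecutive⁻ {fs = _ ∷ _ ∷ _} (there h∈) =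
  let f , g , adj , h≡ = ∈-consecutive⁻ h∈ in f , g , there adj , h≡

-- The lowered family F ↓ s

data Side : Set where
  left right : Side

parent : Side → Iv → Iv → Iv
parent left f g = f
parent right f g = g

module Lowering (F : Family) (s : Iv) where

  S : List Iv
  S = sortByLo (maximals F s)

  S-maximal : m ∈ S → IsMaximal F s m
  S-maximal = ∈-maximals⁻ {F = F} {s = s} ∘ ∈-resp-↭ (sortByLo-↭ (maximals F s))

  maximal∈S : IsMaximal F s m → m ∈ S
  maximal∈S = ∈-resp-↭ (↭-sym (sortByLo-↭ (maximals F s))) ∘ ∈-maximals⁺ {F = F} {s = s}

  S-sorted : AllPairs LoLe S
  S-sorted = sortByLo-sorted (maximals F s)

  S-unique : Unique S
  S-unique =
    sortByLo-unique (deduplicate-! _≟ᵢ_ (filter (λ f → ¬? (any? (f ⊊ᵢ?_) (F ∣ s))) (F ∣ s)))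

  parent-maximal : ∀ σ → Adjacent f g S → IsMaximal F s (parent σ f g)
  parent-maximal left adj = S-maximal (adjacent-∈ˡ adj)
  parent-maximal right adj = S-maximal (adjacent-∈ʳ adj)

  parent-∈F : ∀ σ → Adjacent f g S → parent σ f g ∈ F
  parent-∈F σ adj = proj₁ (∈-∣⁻ F s (member (parent-maximal σ adj)))

  parent-⊆ᵢs : ∀ σ → Adjacent f g S → parent σ f g ⊆ᵢ s
  parent-⊆ᵢs σ adj = proj₂ (∈-∣⁻ F s (member (parent-maximal σ adj)))

  overlapOf⊆ᵢparent : ∀ σ → Adjacent f g S → overlapOf f g ⊆ᵢ parent σ f g
  overlapOf⊆ᵢparent left adj = adjacent-rel S-sorted adj , ≤-refl
  overlapOf⊆ᵢparent right adj =
    ≤-refl , hi≤hi-maximal (parent-maximal right adj) (member (parent-maximal left adj))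
                           (adjacent-rel S-sorted adj)

  parent-injective : ∀ σ {f₁ g₁ f₂ g₂} → Adjacent f₁ g₁ S → Adjacent f₂ g₂ S →
    parent σ f₁ g₁ ≡ parent σ f₂ g₂ → overlapOf f₁ g₁ ≡ overlapOf f₂ g₂
  parent-injective left {f₁} adj₁ adj₂ refl =
    cong (overlapOf f₁) (adjacent-functionalʳ S-unique adj₁ adj₂)
  parent-injective right {g₁ = g₁} adj₁ adj₂ refl =
    cong (λ f → overlapOf f g₁) (adjacent-functionalˡ S-unique adj₁ adj₂)

  data Origin (h : Iv) : Set where
    kept : h ∈ F → h ∉ maximals F s → Origin h
    fromOverlap : Adjacent f g S → h ≡ overlapOf f g → Origin h

  origin : h ∈ F ↓ s → Origin h
  origin h∈ with ∈-++⁻ (filter (λ f → ¬? (any? (f ≟ᵢ_) (maximals F s))) F) h∈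
  ... | inj₁ h∈kept =
    let h∈F , h∉ = ∈-filter⁻ (λ f → ¬? (any? (f ≟ᵢ_) (maximals F s))) h∈kept
    in kept h∈F h∉
  ... | inj₂ h∈new = let _ , _ , adj , h≡ = ∈-consecutive⁻ h∈new in fromOverlap adj h≡

  lift : Side → Origin h → Iv
  lift {h} σ (kept _ _) = h
  lift σ (fromOverlap {f} {g} _ _) = parent σ f g

  ⊆ᵢ-lift : ∀ σ (o : Origin h) → h ⊆ᵢ lift σ o
  ⊆ᵢ-lift σ (kept _ _) = ⊆ᵢ-refl
  ⊆ᵢ-lift σ (fromOverlap adj refl) = overlapOf⊆ᵢparent σ adj

  lift-injective : ∀ σ {h₁ h₂} (o₁ : Origin h₁) (o₂ : Origin h₂) → lift σ o₁ ≡ lift σ o₂ → h₁ ≡ h₂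
  lift-injective σ (kept _ _) (kept _ _) eq = eq
  lift-injective σ (kept _ h∉) (fromOverlap adj _) refl =
    ⊥-elim (h∉ (∈-maximals⁺ {F = F} {s = s} (parent-maximal σ adj)))
  lift-injective σ (fromOverlap adj _) (kept _ h∉) refl =
    ⊥-elim (h∉ (∈-maximals⁺ {F = F} {s = s} (parent-maximal σ adj)))
  lift-injective σ (fromOverlap adj₁ refl) (fromOverlap adj₂ refl) eq = parent-injective σ adj₁ adj₂ eq

  ParentsWithin : Side → Iv → Iv → Set
  ParentsWithin σ t w = ∀ {f g} → Adjacent f g S → overlapOf f g ⊆ᵢ t → parent σ f g ⊆ᵢ w

  leftParentsWithin : t ⊆ᵢ w → lo w ≤ lo s → ParentsWithin left t w
  leftParentsWithin (_ , hi≤) lo≤ adj (_ , hi-f≤) =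
    ≤-trans lo≤ (proj₁ (parent-⊆ᵢs left adj)) , ≤-trans hi-f≤ hi≤

  rightParentsWithin : hi s ≤ hi t → ParentsWithin right t t
  rightParentsWithin hi≤ adj (lo≤ , _) = lo≤ , ≤-trans (proj₂ (parent-⊆ᵢs right adj)) hi≤

  atMostOneContains-lower : ∀ σ {y} → t ⊆ᵢ w → ParentsWithin σ t w →
    AtMostOneContains y (F ∣ w) → AtMostOneContains y ((F ↓ s) ∣ t)
  atMostOneContains-lower {t} {w} σ t⊆w within atMostOne h₁∈ h₂∈ y∈h₁ y∈h₂ =
    let h₁∈F↓s , h₁⊆t = ∈-∣⁻ (F ↓ s) t h₁∈
        h₂∈F↓s , h₂⊆t = ∈-∣⁻ (F ↓ s) t h₂∈
        o₁ = origin h₁∈F↓s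
        o₂ = origin h₂∈F↓s
    in lift-injective σ o₁ o₂
         (atMostOne (lift∈F∣w o₁ h₁⊆t) (lift∈F∣w o₂ h₂⊆t)
                    (∈ᵢ-resp-⊆ᵢ y∈h₁ (⊆ᵢ-lift σ o₁)) (∈ᵢ-resp-⊆ᵢ y∈h₂ (⊆ᵢ-lift σ o₂)))
    where
    lift∈F∣w : (o : Origin h) → h ⊆ᵢ t → lift σ o ∈ F ∣ w
    lift∈F∣w (kept h∈F _) h⊆t = ∈-∣⁺ F w h∈F (⊆ᵢ-trans h⊆t t⊆w)
    lift∈F∣w (fromOverlap adj refl) o⊆t = ∈-∣⁺ F w (parent-∈F σ adj) (within adj o⊆t)

  good-lower : ∀ σ {y} → y ∈ᵢ t → t ⊆ᵢ w → ParentsWithin σ t w →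
    N y (F ∣ w) ℕ.≤ 1 → Good (F ↓ s) t
  good-lower {t} {w} σ {y} y∈t t⊆w within N≤1 =
    y , y∈t , atMostOneContains⇒N≤1 y ((F ↓ s) ∣ t)
                (atMostOneContains-lower σ t⊆w within (N≤1⇒atMostOneContains y (F ∣ w) N≤1))

  overlapInside? : ∀ t → (∃₂ λ f g → Adjacent f g S × overlapOf f g ⊆ᵢ t)
                       ⊎ (∀ {f g} → Adjacent f g S → ¬ overlapOf f g ⊆ᵢ t)
  overlapInside? t with any? (_⊆ᵢ? t) (consecutive S)
  ... | yes inside =
    let _ , o∈ , o⊆t = find inside
        f , g , adj , o≡ = ∈-consecutive⁻ o∈
    in inj₁ (f , g , adj , subst (_⊆ᵢ t) o≡ o⊆t)
  ... | no noneInside = inj₂ λ adj o⊆t → noneInside (lose (∈-consecutive⁺ adj) o⊆t)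

  -- The maximal member covering h cannot start at or after lo g, so it comes before g in S.
  hi≤hi-left-of-overlap : ∀ {y} → Adjacent f g S → h ∈ F ∣ s → y ∈ᵢ h → y < lo g → hi h ≤ hi f
  hi≤hi-left-of-overlap adj h∈ (lo≤y , _) y<lo with maximal-cover h∈
  ... | m , m-maximal , lo≤ , hi≤ with adjacent-split ≤-refl S-sorted adj (maximal∈S m-maximal)
  ... | inj₁ lo-m≤lo-f =
    ≤-trans hi≤ (hi≤hi-maximal (S-maximal (adjacent-∈ˡ adj)) (member m-maximal) lo-m≤lo-f)
  ... | inj₂ lo-g≤lo-m = ⊥-elim (<⇒≱ y<lo (≤-trans lo-g≤lo-m (≤-trans lo≤ lo≤y)))

  atMostOneContains-left-of-overlap : ∀ {y} → Adjacent f g S → y < lo g → lo w ≤ lo s →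
    hi f ≤ hi w → AtMostOneContains y (F ∣ w) → AtMostOneContains y (F ∣ s)
  atMostOneContains-left-of-overlap {w = w} {y} adj y<lo lo≤ hi≤ atMostOne h₁∈ h₂∈ y∈h₁ y∈h₂ =
    atMostOne (∈F∣w h₁∈ y∈h₁) (∈F∣w h₂∈ y∈h₂) y∈h₁ y∈h₂
    where
    ∈F∣w : h ∈ F ∣ s → y ∈ᵢ h → h ∈ F ∣ w
    ∈F∣w h∈ y∈h =
      let h∈F , lo-s≤ , _ = ∈-∣⁻ F s h∈
      in ∈-∣⁺ F w h∈F (≤-trans lo≤ lo-s≤ , ≤-trans (hi≤hi-left-of-overlap adj h∈ y∈h y<lo) hi≤)

minimalBad⇒good : ∀ F s → MinimalBad F s → IsInterval w → w ⊆ᵢ s → w ≢ s → Good F w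
minimalBad⇒good F s (_ , _ , minimal) w-int w⊆s w≢s =
  decidable-stable (Good? F _ w-int) (minimal _ w-int w⊆s w≢s)

module _ (F : Family) (s : Iv) where
  open Lowering F s

  good-lower-left : lo t ≤ lo s → Good F t → Good (F ↓ s) t
  good-lower-left lo≤ (x , x∈t , N≤1) =
    good-lower left x∈t ⊆ᵢ-refl (leftParentsWithin ⊆ᵢ-refl lo≤) N≤1

  good-lower-right : hi s ≤ hi t → Good F t → Good (F ↓ s) t
  good-lower-right hi≤ (x , x∈t , N≤1) =
    good-lower right x∈t ⊆ᵢ-refl (rightParentsWithin hi≤) N≤1

  good-lower-inside : MinimalBad F s → lo s < lo t → hi t < hi s → IsInterval t → Good F t →
    Good (F ↓ s) t
  good-lower-inside {t} s-minBad@(_ , s-bad , _) lo< hi< t-int (x , x∈t , N≤1)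
    with minimalBad⇒good F s s-minBad (<-≤-trans lo< (<⇒≤ t-int)) (≤-refl , <⇒≤ hi<)
                         (λ w≡s → <-irrefl (cong hi w≡s) hi<)
  ... | y , (lo≤y , y<hi) , Ny≤1 with lo t ≤? y | overlapInside? t
  ... | yes lo≤ | _ =
    good-lower left (lo≤ , y<hi) t⊆w (leftParentsWithin t⊆w ≤-refl) Ny≤1
    where
    t⊆w : t ⊆ᵢ (lo s , hi t)
    t⊆w = <⇒≤ lo< , ≤-refl
  ... | no _ | inj₂ noneInside =
    good-lower left x∈t ⊆ᵢ-refl (λ adj o⊆t → ⊥-elim (noneInside adj o⊆t)) N≤1
  ... | no lo≰ | inj₁ (_ , _ , adj , lo≤ , hi≤) =
    ⊥-elim (s-bad (y , (lo≤y , <-trans y<hi hi<) , atMostOneContains⇒N≤1 y (F ∣ s)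
      (atMostOneContains-left-of-overlap adj (<-≤-trans (≰⇒> lo≰) lo≤) ≤-refl hi≤
        (N≤1⇒atMostOneContains y (F ∣ (lo s , hi t)) Ny≤1))))

mainTheorem5 : (F : Family) (s t : Iv) → IsFamily F → MinimalBad F s →
    IsInterval t → Good F t → Good (F ↓ s) t
mainTheorem5 F s t _ s-minBad t-int t-good with lo t ≤? lo s | hi s ≤? hi t
... | yes lo≤ | _ = good-lower-left F s lo≤ t-good
... | no _ | yes hi≤ = good-lower-right F s hi≤ t-good
... | no lo≰ | no hi≰ = good-lower-inside F s s-minBad (≰⇒> lo≰) (≰⇒> hi≰) t-int t-good
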